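{- Let $\mathcal A=(S,A)$ and $\mathcal A'=(S',A')$ be reaction systems. Then the transition graphs $G_{\mathcal A}$ and $G_{\mathcal A'}$ are isomorphic if and only if the $0$-context graphs $G^0_{\mathcal A}$ and $G^0_{\mathcal A'}$ are companions, i.e. if and only if the main skeletons $(\mathrm{Up}[R],R,\mathrm{res}_{\mathcal A})$ with $R=\mathrm{res}_{\mathcal A}(2^S)$ over $2^S$ and $(\mathrm{Up}[R'],R',\mathrm{res}_{\mathcal A'})$ with $R'=\mathrm{res}_{\mathcal A'}(2^{S'})$ over $2^{S'}$ are companion skeletons.
   Context: A reaction system is a pair $\mathcal A=(S,A)$ with $S$ a finite set and $A\subseteq(2^S\setminus\{\varnothing\})\times(2^S\setminus\{\varnothing\})\times 2^S$ a set of reactions $(R,I,P)$; $a=(R,I,P)$ is enabled in $X\subseteq S$ iff $R\subseteq X$ and $I\cap X=\varnothing$; $\mathrm{res}_a(X)=P$ if enabled and $\varnothing$ otherwise; $\mathrm{res}_{\mathcal A}(X)=\bigcup_{a\in A}\mathrm{res}_a(X)$. The $0$-context graph $G^0_{\mathcal A}$ has vertex set $2^S$ and edges $(v,\mathrm{res}_{\mathcal A}(v))$; the transition graph $G_{\mathcal A}$ has vertex set $2^S$ and edges $(v,w)$ with $\mathrm{res}_{\mathcal A}(v)\subseteq w$. In $(2^S,\subseteq)$, $\mathrm{Up}(X)=\{Y\subseteq S\mid X\subseteq Y\}$ and $\mathrm{Up}[R]=\{\mathrm{Up}(X)\mid X\in R\}$, where the cone $\mathrm{Up}(X)$ is indexed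 by $X$. A skeleton over a finite set $V$ is a triple $(\mathcal O,R,f)$ where $R\subseteq V$, $\mathcal O=\{O_z\mid z\in R\}$ is a family of subsets of $V$ indexed injectively by $R$ with $|\mathcal O|\le |V|$, and $f:V\to R$ is a surjection. For a family $\mathcal O$, $\mathcal O^\cap$ is the smallest family containing $\mathcal O$ closed under intersection of two sets; a faithful correspondence is a bijection $\eta:\mathcal O^\cap\to\mathcal P^\cap$ with $|X|=|\eta(X)|$ and $\eta(X\cap Y)=\eta(X)\cap\eta(Y)$. Skeletons $(\mathcal O,R,f)$ over $V$ and $(\mathcal P,Q,g)$ over $W$ are companions if there is a bijection $\eta:V\to W$ whose elementwise extension to subsets restricts to a faithful correspondence $\mathcal O^\cap\to\mathcal P^\cap$ and satisfies $\eta(O_{f(x)})=P_{g(\eta(x))}$ for all $x\in V$. -}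

module Defs where

open import Data.Bool using (Bool; true; false; _∧_; not; if_then_else_)
open import Data.Nat using (ℕ; zero; suc; _+_)
open import Data.List using (List; []; _∷_; map; _++_; foldr)
open import Data.List.Relation.Unary.All using (All)
open import Data.Vec using ([]; _∷_)
open import Data.Product using (Σ; _×_; _,_; ∃)
open import Data.Fin.Subset using (Subset; _⊆_; _∩_; _∪_; ⊥; Nonempty)
open import Data.Fin.Subset.Properties using (_⊆?_; nonempty?)
open import Relation.Nullary using (does)
open import Relation.Binary.PropositionalEquality using (_≡_; _≗_)
open import Function.Bundles using (Inverse; _↔_)

record Reaction (n : ℕ) : Set where
  constructor reaction
  field
    R I P : Subset n

-- A reaction system (S , A) with S = Fin n; A is given as a list of
-- reactions (duplicates are irrelevant for res), each with R, I nonempty.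
record ReactionSystem (n : ℕ) : Set where
  field
    reactions : List (Reaction n)
    nonemptyRI : All (λ a → Nonempty (Reaction.R a) × Nonempty (Reaction.I a)) reactions

enabled : ∀ {n} → Reaction n → Subset n → Bool
enabled a X = does (Reaction.R a ⊆? X) ∧ not (does (nonempty? (Reaction.I a ∩ X)))

res-reaction : ∀ {n} → Reaction n → Subset n → Subset n
res-reaction a X = if enabled a X then Reaction.P a else ⊥

res : ∀ {n} → ReactionSystem n → Subset n → Subset n
res 𝒜 X = foldr (λ a acc → res-reaction a X ∪ acc) ⊥ (ReactionSystem.reactions 𝒜)

TEdge : ∀ {n} → ReactionSystem n → Subset n → Subset n → Set
TEdge 𝒜 v w = res 𝒜 v ⊆ w

TransitionIso : ∀ {n m} → ReactionSystem n → ReactionSystem m → Set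
TransitionIso {n} {m} 𝒜 𝒜' =
  Σ (Subset n ↔ Subset m) λ φ →
    ∀ v w → (TEdge 𝒜 v w → TEdge 𝒜' (Inverse.to φ v) (Inverse.to φ w))
          × (TEdge 𝒜' (Inverse.to φ v) (Inverse.to φ w) → TEdge 𝒜 v w)

-- Subsets of the vertex set V = 2^S = Subset n, as decidable
-- (boolean-valued) predicates; equality of such subsets is pointwise (≗).

VSet : ℕ → Set
VSet n = Subset n → Bool

_∩V_ : ∀ {n} → VSet n → VSet n → VSet n
(X ∩V Y) v = X v ∧ Y v

Up : ∀ {n} → Subset n → VSet n
Up X Y = does (X ⊆? Y)

allSubsets : ∀ n → List (Subset n)
allSubsets zero = [] ∷ []
allSubsets (suc n) = map (true ∷_) (allSubsets n) ++ map (false ∷_) (allSubsets n)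

card : ∀ {n} → VSet n → ℕ
card X = foldr (λ v acc → (if X v then 1 else 0) + acc) 0 (allSubsets _)

-- Families are sets of sets, hence closed under equality of sets (≗).
data Closure∩ {n} (𝒪 : VSet n → Set) : VSet n → Set where
  base  : ∀ {X} → 𝒪 X → Closure∩ 𝒪 X
  inter : ∀ {X Y} → Closure∩ 𝒪 X → Closure∩ 𝒪 Y → Closure∩ 𝒪 (X ∩V Y)
  ext   : ∀ {X Y} → X ≗ Y → Closure∩ 𝒪 X → Closure∩ 𝒪 Y

InImage : ∀ {n} → ReactionSystem n → Subset n → Set
InImage 𝒜 z = ∃ λ v → res 𝒜 v ≡ z

UpFamily : ∀ {n} → ReactionSystem n → VSet n → Set
UpFamily 𝒜 X = Σ _ λ z → InImage 𝒜 z × (X ≗ Up z)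

-- elementwise extension of a bijection η : V → W to subsets:
-- η(X) = { η x | x ∈ X } = { w | η⁻¹ w ∈ X }.
image : ∀ {n m} → (Subset n ↔ Subset m) → VSet n → VSet m
image η X w = X (Inverse.from η w)

FaithfulCorrespondence : ∀ {n m} → (Subset n ↔ Subset m) →
                         (VSet n → Set) → (VSet m → Set) → Set
FaithfulCorrespondence η 𝒪 𝒫 =
    (∀ X → Closure∩ 𝒪 X → Closure∩ 𝒫 (image η X))
  × (∀ X X' → Closure∩ 𝒪 X → Closure∩ 𝒪 X' → image η X ≗ image η X' → X ≗ X')
  × (∀ Y → Closure∩ 𝒫 Y → Σ _ λ X → Closure∩ 𝒪 X × (image η X ≗ Y))
  × (∀ X → Closure∩ 𝒪 X → card X ≡ card (image η X))
  × (∀ X Y → Closure∩ 𝒪 X → Closure∩ 𝒪 Y →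
       image η (X ∩V Y) ≗ (image η X ∩V image η Y))

-- The main skeletons (Up[R], R, res_𝒜) over 2^S and (Up[R'], R', res_𝒜')
-- over 2^S' are companions (O_z = Up(z), f = res_𝒜).
CompanionMainSkeletons : ∀ {n m} → ReactionSystem n → ReactionSystem m → Set
CompanionMainSkeletons {n} {m} 𝒜 𝒜' =
  Σ (Subset n ↔ Subset m) λ η →
      FaithfulCorrespondence η (UpFamily 𝒜) (UpFamily 𝒜')
    × (∀ x → image η (Up (res 𝒜 x)) ≗ Up (res 𝒜' (Inverse.to η x)))

-- In the transition graph the out-neighbourhood of a vertex v is exactly the
-- cone Up(res v).  Hence a bijection η : 2^S → 2^S' is an isomorphism of
-- transition graphs iff η maps Up(res v) onto Up(res' (η v)) for every v,
-- which is the compatibility condition η(O_{f(x)}) = P_{g(η x)} of companion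
-- skeletons.  The faithfulness condition comes for free: the elementwise
-- image of any bijection preserves cardinalities and intersections, so it is
-- a faithful correspondence between the ∩-closures of any two families it
-- maps onto each other, and a cone-preserving η maps Up[R] onto Up[R'].
module Submission where

open import Defs
open import Data.Bool using (true; false; _∧_; if_then_else_)
open import Data.Empty using (⊥)
open import Data.Nat using (ℕ; zero; suc; _+_)
open import Data.Nat.ListAction using (sum)
open import Data.Nat.ListAction.Properties using (sum-↭)
open import Data.Product using (Σ; _×_; _,_; proj₁; proj₂)
open import Data.List using (map)
open import Data.List.Properties using (map-∘; foldr-map)
open import Data.List.Membership.Propositional using (_∈_)
open import Data.List.Membership.Propositional.Properties
  using (∈-map⁺; ∈-map⁻; ∈-++⁺ˡ; ∈-++⁺ʳ)
open import Data.List.Membership.Propositional.Properties.WithK using (unique∧set⇒bag)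
open import Data.List.Relation.Binary.BagAndSetEquality using (∼bag⇒↭)
open import Data.List.Relation.Binary.Permutation.Propositional using (_↭_)
open import Data.List.Relation.Binary.Permutation.Propositional.Properties
  using () renaming (map⁺ to ↭-map⁺)
open import Data.List.Relation.Unary.All using ([])
open import Data.List.Relation.Unary.Any using (here)
open import Data.List.Relation.Unary.Unique.Propositional using (Unique; []; _∷_)
open import Data.List.Relation.Unary.Unique.Propositional.Properties
  using () renaming (map⁺ to Unique-map⁺; ++⁺ to Unique-++⁺)
open import Data.Vec using ([]; _∷_)
open import Data.Vec.Properties using (∷-injectiveʳ)
open import Data.Fin.Subset using (Subset; _⊆_)
open import Data.Fin.Subset.Properties using (_⊆?_)
open import Function.Bundles using (Inverse; _↔_; mk⇔)
open import Relation.Nullary using (Dec; yes; no; does; contradiction)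
open import Relation.Nullary.Decidable using (dec-true; does-⇔)
open import Relation.Binary.PropositionalEquality

∈-allSubsets : ∀ n (x : Subset n) → x ∈ allSubsets n
∈-allSubsets zero    []          = here refl
∈-allSubsets (suc n) (true ∷ x)  = ∈-++⁺ˡ (∈-map⁺ (true ∷_) (∈-allSubsets n x))
∈-allSubsets (suc n) (false ∷ x) =
  ∈-++⁺ʳ (map (true ∷_) (allSubsets n)) (∈-map⁺ (false ∷_) (∈-allSubsets n x))

allSubsets-unique : ∀ n → Unique (allSubsets n)
allSubsets-unique zero    = [] ∷ []
allSubsets-unique (suc n) =
  Unique-++⁺ (Unique-map⁺ ∷-injectiveʳ (allSubsets-unique n))
             (Unique-map⁺ ∷-injectiveʳ (allSubsets-unique n))
             disjoint
  where
  disjoint : ∀ {v} → v ∈ map (true ∷_) (allSubsets n) × v ∈ map (false ∷_) (allSubsets n) → ⊥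
  disjoint (p , q) with ∈-map⁻ (true ∷_) p | ∈-map⁻ (false ∷_) q
  ... | _ , _ , refl | _ , _ , ()

indicator : ∀ {n} → VSet n → Subset n → ℕ
indicator X v = if X v then 1 else 0

card≡sum-indicator : ∀ {n} (X : VSet n) → card X ≡ sum (map (indicator X) (allSubsets n))
card≡sum-indicator {n} X = sym (foldr-map _+_ (indicator X) 0 (allSubsets n))

does-transport : ∀ {A B : Set} (a? : Dec A) (b? : Dec B) → does a? ≡ does b? → A → B
does-transport a? (yes b) _  _ = b
does-transport a? (no ¬b) eq a = contradiction (trans (sym (dec-true a? a)) eq) λ ()

module _ {n m} (η : Subset n ↔ Subset m) where
  open Inverse η

  from-injective : ∀ {x y} → from x ≡ from y → x ≡ y
  from-injective {x} {y} eq =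
    trans (sym (strictlyInverseˡ x)) (trans (cong to eq) (strictlyInverseˡ y))

  allSubsets↭map-from : allSubsets n ↭ map from (allSubsets m)
  allSubsets↭map-from = ∼bag⇒↭ (unique∧set⇒bag
    (allSubsets-unique n)
    (Unique-map⁺ from-injective (allSubsets-unique m))
    (λ {x} → mk⇔ (λ _ → subst (_∈ map from (allSubsets m)) (strictlyInverseʳ x)
                                (∈-map⁺ from (∈-allSubsets m (to x))))
                 (λ _ → ∈-allSubsets n x)))

  card-image : ∀ X → card X ≡ card (image η X)
  card-image X = begin
    card X                                               ≡⟨ card≡sum-indicator X ⟩
    sum (map (indicator X) (allSubsets n))               ≡⟨ sum-↭ (↭-map⁺ (indicator X) allSubsets↭map-from) ⟩
    sum (map (indicator X) (map from (allSubsets m)))    ≡⟨ cong sum (map-∘ (allSubsets m)) ⟨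
    sum (map (indicator (image η X)) (allSubsets m))     ≡⟨ card≡sum-indicator (image η X) ⟨
    card (image η X)                                     ∎
    where open ≡-Reasoning

  image-cong : ∀ {X Y} → X ≗ Y → image η X ≗ image η Y
  image-cong X≗Y w = X≗Y (from w)

  image-injective : ∀ {X Y} → image η X ≗ image η Y → X ≗ Y
  image-injective {X} {Y} eq v =
    trans (cong X (sym (strictlyInverseʳ v)))
          (trans (eq (to v)) (cong Y (strictlyInverseʳ v)))

  PreimageIn : (VSet n → Set) → VSet m → Set
  PreimageIn 𝒬 Y = Σ (VSet n) λ X → 𝒬 X × (image η X ≗ Y)

  module _ {𝒪 : VSet n → Set} {𝒫 : VSet m → Set} where

    image-Closure∩ : (∀ X → 𝒪 X → Closure∩ 𝒫 (image η X)) →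
                     ∀ X → Closure∩ 𝒪 X → Closure∩ 𝒫 (image η X)
    image-Closure∩ image-𝒪 X (base p)    = image-𝒪 X p
    image-Closure∩ image-𝒪 _ (inter p q) = inter (image-Closure∩ image-𝒪 _ p) (image-Closure∩ image-𝒪 _ q)
    image-Closure∩ image-𝒪 _ (ext eq p)  = ext (image-cong eq) (image-Closure∩ image-𝒪 _ p)

    Closure∩-preimage : (∀ Y → 𝒫 Y → PreimageIn (Closure∩ 𝒪) Y) →
                        ∀ Y → Closure∩ 𝒫 Y → PreimageIn (Closure∩ 𝒪) Y
    Closure∩-preimage onto Y (base p) = onto Y p
    Closure∩-preimage onto _ (inter p q)
      with Closure∩-preimage onto _ p | Closure∩-preimage onto _ q
    ... | X , cX , eqX | X' , cX' , eqX' =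
      X ∩V X' , inter cX cX' , λ w → cong₂ _∧_ (eqX w) (eqX' w)
    Closure∩-preimage onto _ (ext eq p) with Closure∩-preimage onto _ p
    ... | X , cX , eqX = X , cX , λ w → trans (eqX w) (eq w)

    faithfulCorrespondence : (∀ X → 𝒪 X → Closure∩ 𝒫 (image η X)) →
                             (∀ Y → 𝒫 Y → PreimageIn (Closure∩ 𝒪) Y) →
                             FaithfulCorrespondence η 𝒪 𝒫
    faithfulCorrespondence image-𝒪 onto =
        image-Closure∩ image-𝒪
      , (λ _ _ _ _ → image-injective)
      , Closure∩-preimage onto
      , (λ X _ → card-image X)
      , (λ _ _ _ _ _ → refl)

  module _ (f : Subset n → Subset n) (g : Subset m → Subset m) where

    PreservesEdges : Set
    PreservesEdges = ∀ v w → (f v ⊆ w → g (to v) ⊆ to w) × (g (to v) ⊆ to w → f v ⊆ w)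

    MapsUpCones : Set
    MapsUpCones = ∀ x → image η (Up (f x)) ≗ Up (g (to x))

    preservesEdges⇒mapsUpCones : PreservesEdges → MapsUpCones
    preservesEdges⇒mapsUpCones edges x w =
      does-⇔ (mk⇔ forth back) (f x ⊆? from w) (g (to x) ⊆? w)
      where
      forth : f x ⊆ from w → g (to x) ⊆ w
      forth e = subst (g (to x) ⊆_) (strictlyInverseˡ w) (proj₁ (edges x (from w)) e)
      back : g (to x) ⊆ w → f x ⊆ from w
      back e = proj₂ (edges x (from w)) (subst (g (to x) ⊆_) (sym (strictlyInverseˡ w)) e)

    mapsUpCones⇒preservesEdges : MapsUpCones → PreservesEdges
    mapsUpCones⇒preservesEdges cones v w =
        (λ e → does-transport (f v ⊆? from (to w)) (g (to v) ⊆? to w) (cones v (to w))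
                              (subst (f v ⊆_) (sym (strictlyInverseʳ w)) e))
      , (λ e → subst (f v ⊆_) (strictlyInverseʳ w)
                 (does-transport (g (to v) ⊆? to w) (f v ⊆? from (to w)) (sym (cones v (to w))) e))

  module _ (𝒜 : ReactionSystem n) (𝒜' : ReactionSystem m)
           (cones : MapsUpCones (res 𝒜) (res 𝒜')) where

    image-UpFamily : ∀ X → UpFamily 𝒜 X → Closure∩ (UpFamily 𝒜') (image η X)
    image-UpFamily X (_ , (v , refl) , X≗Up) =
      base (res 𝒜' (to v) , (to v , refl) , λ w → trans (image-cong X≗Up w) (cones v w))

    UpFamily-preimage : ∀ Y → UpFamily 𝒜' Y → PreimageIn (Closure∩ (UpFamily 𝒜)) Y
    UpFamily-preimage Y (_ , (v , refl) , Y≗Up) =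
        Up (res 𝒜 (from v))
      , base (res 𝒜 (from v) , (from v , refl) , λ _ → refl)
      , λ w → trans (cones (from v) w)
                    (trans (cong (λ u → Up (res 𝒜' u) w) (strictlyInverseˡ v)) (sym (Y≗Up w)))

theorem5p7 : ∀ {n m} (𝒜 : ReactionSystem n) (𝒜' : ReactionSystem m) →
    (TransitionIso 𝒜 𝒜' → CompanionMainSkeletons 𝒜 𝒜')
      × (CompanionMainSkeletons 𝒜 𝒜' → TransitionIso 𝒜 𝒜')
theorem5p7 𝒜 𝒜' =
    (λ (φ , edges) →
       let cones = preservesEdges⇒mapsUpCones φ (res 𝒜) (res 𝒜') edges
       in φ
        , faithfulCorrespondence φ (image-UpFamily φ 𝒜 𝒜' cones) (UpFamily-preimage φ 𝒜 𝒜' cones)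
        , cones)
  , (λ (η , _ , cones) → η , mapsUpCones⇒preservesEdges η (res 𝒜) (res 𝒜') cones)
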